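{- Let $T$ be the Thue-Morse word. Then $\mathcal P^{(2)}_T(n) = O(\log n)$ as $n \to \infty$; $\mathcal P^{(2)}_T\!\left(\frac{2 \cdot 4^m + 4}{3}\right) = \Theta(m)$ as $m \to \infty$; and $\mathcal P^{(2)}_T(2^m + 1) \leq 8$ for all integers $m \geq 0$.
   Context: The Thue-Morse word $T$ is the fixed point beginning with $0$ of the morphism $\tau(0) = 01$, $\tau(1) = 10$ on $\{0,1\}$. Two finite words $u, v$ are 2-Abelian equivalent if every nonempty word of length at most $2$ occurs as a factor the same number of times in $u$ and in $v$. $\mathcal P^{(2)}_T(n)$ is the number of 2-Abelian equivalence classes among the factors of $T$ of length $n$. -}

module Defs where

open import Data.Bool using (Bool; true; false; if_then_else_; _∧_)
open import Data.Nat using (ℕ; zero; suc; _+_; _≤_)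
open import Data.List using (List; []; _∷_; concatMap; map; upTo; length)
open import Data.Fin using (Fin)
open import Data.Product using (Σ; ∃; _×_)
open import Relation.Binary.PropositionalEquality using (_≡_; _≢_)
open import Relation.Nullary using (¬_)

-- Alphabet {0,1} is represented by Bool, with false = 0 and true = 1.

τ : Bool → List Bool
τ false = false ∷ true ∷ []
τ true  = true ∷ false ∷ []

τ^[_]0 : ℕ → List Bool
τ^[ zero ]0  = false ∷ []
τ^[ suc k ]0 = concatMap τ τ^[ k ]0

nth : List Bool → ℕ → Bool
nth []       _       = false
nth (x ∷ _)  zero    = x
nth (_ ∷ xs) (suc n) = nth xs n

-- The Thue–Morse word T (fixed point of τ beginning with 0), as a function ℕ → {0,1}.
-- T(n) is read off the prefix τ^n(0), which has length 2^n > n.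
T : ℕ → Bool
T n = nth τ^[ n ]0 n

factor : ℕ → ℕ → List Bool
factor i n = map (λ j → T (i + j)) (upTo n)

isPrefix : List Bool → List Bool → Bool
isPrefix []       _        = true
isPrefix (_ ∷ _)  []       = false
isPrefix (a ∷ w)  (b ∷ u)  = (if a then b else (if b then false else true)) ∧ isPrefix w u

occ : List Bool → List Bool → ℕ
occ w []        = if isPrefix w [] then 1 else 0
occ w (x ∷ u)   = (if isPrefix w (x ∷ u) then 1 else 0) + occ w u

_≈₂_ : List Bool → List Bool → Set
u ≈₂ v = (w : List Bool) → 1 ≤ length w → length w ≤ 2 → occ w u ≡ occ w v

-- HasP2 n k : among the factors of T of length n there are exactly k
-- 2-Abelian equivalence classes, i.e. there are k factors (given by starting
-- positions rep i) which are pairwise non-equivalent and every factor of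
-- length n is equivalent to one of them.
HasP2 : ℕ → ℕ → Set
HasP2 n k = Σ (Fin k → ℕ) λ rep →
    ((i j : Fin k) → i ≢ j → ¬ (factor (rep i) n ≈₂ factor (rep j) n))
  × ((p : ℕ) → ∃ λ (i : Fin k) → factor p n ≈₂ factor (rep i) n)

-- A factor of T of length L + 1 is determined up to 2-Abelian equivalence by its two end
-- letters, its number of 0s and its number of factors 00 and 11 ("squares"); a factor of
-- length n already occurs before position 6·2^n, so class counts exist.  Since T(2j) = T(j)
-- and T(2j+1) = ¬T(j), the number of 0s of a window is within 1 of half its length, and the
-- squares of a window of length 2M (or 2M + 1) are the non-squares of a window of length M (up
-- to one).  Hence the number of squares varies by at most k over windows of length below 2^k,
-- giving O(log n) classes, and by at most 1 over windows of length 2^m, where its parity is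
-- fixed by the other data, giving at most 8 classes for n = 2^m + 1.  Conversely, windows of
-- length (2·4^m + 1)/3 realise m + 1 different numbers of squares.

module Submission where

open import Defs
open import Data.Bool using (Bool; true; false; not; _xor_; if_then_else_)
open import Data.Bool.Properties using (not-distribʳ-xor; xor-identityʳ)
open import Data.Nat hiding (parity)
open import Data.Nat.Properties
open import Data.Nat.DivMod using (_/_; _%_; m≡m%n+[m/n]*n; m%n<n; m*n/n≡m)
open import Data.Nat.Logarithm using (⌊log₂_⌋; ⌊log₂⌋-mono-≤; ⌊log₂[2^n]⌋≡n)
open import Data.Nat.Tactic.RingSolver using (solve-∀)
open import Data.List using (List; []; _∷_; length; concatMap; map; upTo; lookup; deduplicate)
open import Data.List.Relation.Unary.Any as Any using (Any)
open import Data.List.Relation.Unary.Any.Properties using (deduplicate⁺; lookup-index)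
open import Data.List.Relation.Unary.AllPairs using (AllPairs; _∷_)
open import Data.List.Relation.Unary.Unique.DecSetoid.Properties using (deduplicate-!)
open import Data.Fin as Fin using (Fin)
open import Data.Fin.Properties as Fin using (injective⇒≤)
open import Data.List.Properties using (map-upTo; map-∘; map-cong; map-cong-local; length-map; length-upTo)
import Data.List.Relation.Unary.All as All
open import Data.List.Membership.Propositional.Properties using (∈-upTo⁻; ∈-upTo⁺; ∈-lookup)
open import Data.Product using (Σ; ∃; _×_; _,_; proj₁; proj₂)
open import Data.Empty using (⊥; ⊥-elim)
open import Function using (_∘_)
open import Relation.Nullary using (¬_; yes; no)
open import Relation.Nullary.Decidable using (map′; _×-dec_)
open import Relation.Binary.Definitions using (Decidable; tri<; tri≈; tri>)
open import Relation.Binary.Structures using (IsDecEquivalence)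
open import Relation.Binary.Core using (Rel)
import Relation.Binary.Construct.On as On
open import Relation.Binary.PropositionalEquality
open import Algebra.Properties.CommutativeSemigroup +-commutativeSemigroup using ()
  renaming (interchange to +-interchange)

data Parity : ℕ → Set where
  even : ∀ j → Parity (j + j)
  odd  : ∀ j → Parity (suc (j + j))

parity : ∀ n → Parity n
parity zero = even 0
parity (suc n) with parity n
... | even j = odd j
... | odd j  = subst Parity (cong suc (+-suc j j)) (even (suc j))

double-cancel-< : ∀ {j a} → j + j < a + a → j < a
double-cancel-< {j} {a} h with j <? a
... | yes j<a = j<a
... | no  j≮a = ⊥-elim (<⇒≱ h (+-mono-≤ (≮⇒≥ j≮a) (≮⇒≥ j≮a)))

double+1-cancel-< : ∀ {j a} → suc (j + j) < a + a → j < a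
double+1-cancel-< h = double-cancel-< (<-trans (n<1+n _) h)

2^-suc : ∀ k → 2 ^ suc k ≡ 2 ^ k + 2 ^ k
2^-suc k = cong (2 ^ k +_) (+-identityʳ (2 ^ k))

n<2^n : ∀ n → n < 2 ^ n
n<2^n zero    = s≤s z≤n
n<2^n (suc n) = subst (suc n <_) (sym (2^-suc n))
  (+-mono-≤ (m^n>0 2 n) (n<2^n n))

module ThueMorse where

  open ≡-Reasoning

  length-concatMap-τ : ∀ xs → length (concatMap τ xs) ≡ length xs + length xs
  length-concatMap-τ []           = refl
  length-concatMap-τ (false ∷ xs) = cong suc (trans (cong suc (length-concatMap-τ xs)) (sym (+-suc _ _)))
  length-concatMap-τ (true ∷ xs)  = cong suc (trans (cong suc (length-concatMap-τ xs)) (sym (+-suc _ _)))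

  length-τ^[]0 : ∀ k → length τ^[ k ]0 ≡ 2 ^ k
  length-τ^[]0 zero    = refl
  length-τ^[]0 (suc k) = begin
    length (concatMap τ τ^[ k ]0)        ≡⟨ length-concatMap-τ τ^[ k ]0 ⟩
    length τ^[ k ]0 + length τ^[ k ]0    ≡⟨ cong₂ _+_ (length-τ^[]0 k) (length-τ^[]0 k) ⟩
    2 ^ k + 2 ^ k                        ≡⟨ 2^-suc k ⟨
    2 ^ suc k                            ∎

  nth-concatMap-τ-even : ∀ xs j → nth (concatMap τ xs) (j + j) ≡ nth xs j
  nth-concatMap-τ-even []           j       = refl
  nth-concatMap-τ-even (false ∷ xs) zero    = refl
  nth-concatMap-τ-even (true ∷ xs)  zero    = refl
  nth-concatMap-τ-even (false ∷ xs) (suc j) rewrite +-suc j j = nth-concatMap-τ-even xs j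
  nth-concatMap-τ-even (true ∷ xs)  (suc j) rewrite +-suc j j = nth-concatMap-τ-even xs j

  nth-concatMap-τ-odd : ∀ xs j → j < length xs → nth (concatMap τ xs) (suc (j + j)) ≡ not (nth xs j)
  nth-concatMap-τ-odd (false ∷ xs) zero    _       = refl
  nth-concatMap-τ-odd (true ∷ xs)  zero    _       = refl
  nth-concatMap-τ-odd (false ∷ xs) (suc j) (s≤s h) rewrite +-suc j j = nth-concatMap-τ-odd xs j h
  nth-concatMap-τ-odd (true ∷ xs)  (suc j) (s≤s h) rewrite +-suc j j = nth-concatMap-τ-odd xs j h

  nth-τ^[]0-head : ∀ k → nth τ^[ k ]0 0 ≡ false
  nth-τ^[]0-head zero    = refl
  nth-τ^[]0-head (suc k) = trans (nth-concatMap-τ-even τ^[ k ]0 0) (nth-τ^[]0-head k)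

  nth-τ^[]0-coherent : ∀ k k' i → i < 2 ^ k → i < 2 ^ k' → nth τ^[ k ]0 i ≡ nth τ^[ k' ]0 i
  nth-τ^[]0-coherent zero    k'       zero    _ _ = sym (nth-τ^[]0-head k')
  nth-τ^[]0-coherent (suc k) zero     zero    _ _ = nth-τ^[]0-head (suc k)
  nth-τ^[]0-coherent zero    _        (suc _) (s≤s ()) _
  nth-τ^[]0-coherent (suc _) zero     (suc _) _ (s≤s ())
  nth-τ^[]0-coherent (suc k) (suc k') i h h' with parity i
  ... | even j = begin
    nth (concatMap τ τ^[ k ]0) (j + j)   ≡⟨ nth-concatMap-τ-even τ^[ k ]0 j ⟩
    nth τ^[ k ]0 j                       ≡⟨ nth-τ^[]0-coherent k k' j (half k h) (half k' h') ⟩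
    nth τ^[ k' ]0 j                      ≡⟨ nth-concatMap-τ-even τ^[ k' ]0 j ⟨
    nth (concatMap τ τ^[ k' ]0) (j + j)  ∎
    where
    half : ∀ k → j + j < 2 ^ suc k → j < 2 ^ k
    half k h = double-cancel-< (subst (j + j <_) (2^-suc k) h)
  ... | odd j = begin
    nth (concatMap τ τ^[ k ]0) (suc (j + j))   ≡⟨ nth-concatMap-τ-odd τ^[ k ]0 j (inside k h) ⟩
    not (nth τ^[ k ]0 j)                       ≡⟨ cong not (nth-τ^[]0-coherent k k' j (half k h) (half k' h')) ⟩
    not (nth τ^[ k' ]0 j)                      ≡⟨ nth-concatMap-τ-odd τ^[ k' ]0 j (inside k' h') ⟨
    nth (concatMap τ τ^[ k' ]0) (suc (j + j))  ∎
    where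
    half : ∀ k → suc (j + j) < 2 ^ suc k → j < 2 ^ k
    half k h = double+1-cancel-< (subst (suc (j + j) <_) (2^-suc k) h)
    inside : ∀ k → suc (j + j) < 2 ^ suc k → j < length τ^[ k ]0
    inside k h = subst (j <_) (sym (length-τ^[]0 k)) (half k h)

  T-double : ∀ j → T (j + j) ≡ T j
  T-double j = begin
    T (j + j)                            ≡⟨ nth-τ^[]0-coherent (j + j) (suc j) (j + j) (n<2^n _) bound ⟩
    nth (concatMap τ τ^[ j ]0) (j + j)   ≡⟨ nth-concatMap-τ-even τ^[ j ]0 j ⟩
    T j                                  ∎
    where
    bound : j + j < 2 ^ suc j
    bound = subst (j + j <_) (sym (2^-suc j)) (+-mono-≤-< (<⇒≤ (n<2^n j)) (n<2^n j))

  T-double+1 : ∀ j → T (suc (j + j)) ≡ not (T j)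
  T-double+1 j = begin
    T (suc (j + j))                            ≡⟨ nth-τ^[]0-coherent (suc (j + j)) (suc j) _ (n<2^n _) bound ⟩
    nth (concatMap τ τ^[ j ]0) (suc (j + j))   ≡⟨ nth-concatMap-τ-odd τ^[ j ]0 j inside ⟩
    not (T j)                                  ∎
    where
    bound : suc (j + j) < 2 ^ suc j
    bound = subst₂ _≤_ (cong suc (+-suc j j)) (sym (2^-suc j)) (+-mono-≤ (n<2^n j) (n<2^n j))
    inside : j < length τ^[ j ]0
    inside = subst (j <_) (sym (length-τ^[]0 j)) (n<2^n j)

  q*2^[1+k]+[j+j]≡[q*2^k+j]+[q*2^k+j] : ∀ k q j → q * 2 ^ suc k + (j + j) ≡ (q * 2 ^ k + j) + (q * 2 ^ k + j)
  q*2^[1+k]+[j+j]≡[q*2^k+j]+[q*2^k+j] k q j =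
    trans (cong (λ x → q * x + (j + j)) (2^-suc k)) (regroup q (2 ^ k) j)
    where
    regroup : ∀ q a j → q * (a + a) + (j + j) ≡ (q * a + j) + (q * a + j)
    regroup = solve-∀

  T-block : ∀ k q r → r < 2 ^ k → T (q * 2 ^ k + r) ≡ T q xor T r
  T-block zero q zero _ = trans (cong T (trans (+-identityʳ (q * 1)) (*-identityʳ q))) (sym (xor-identityʳ (T q)))
  T-block zero q (suc r) (s≤s ())
  T-block (suc k) q r h with parity r
  ... | even j = begin
    T (q * 2 ^ suc k + (j + j))                 ≡⟨ cong T (q*2^[1+k]+[j+j]≡[q*2^k+j]+[q*2^k+j] k q j) ⟩
    T ((q * 2 ^ k + j) + (q * 2 ^ k + j))       ≡⟨ T-double (q * 2 ^ k + j) ⟩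
    T (q * 2 ^ k + j)                           ≡⟨ T-block k q j (double-cancel-< (subst (j + j <_) (2^-suc k) h)) ⟩
    T q xor T j                                 ≡⟨ cong (T q xor_) (T-double j) ⟨
    T q xor T (j + j)                           ∎
  ... | odd j = begin
    T (q * 2 ^ suc k + suc (j + j))             ≡⟨ cong T (trans (+-suc (q * 2 ^ suc k) (j + j)) (cong suc (q*2^[1+k]+[j+j]≡[q*2^k+j]+[q*2^k+j] k q j))) ⟩
    T (suc ((q * 2 ^ k + j) + (q * 2 ^ k + j))) ≡⟨ T-double+1 (q * 2 ^ k + j) ⟩
    not (T (q * 2 ^ k + j))                     ≡⟨ cong not (T-block k q j (double+1-cancel-< (subst (suc (j + j) <_) (2^-suc k) h))) ⟩
    not (T q xor T j)                           ≡⟨ not-distribʳ-xor (T q) (T j) ⟩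
    T q xor not (T j)                           ≡⟨ cong (T q xor_) (T-double+1 j) ⟨
    T q xor T (suc (j + j))                     ∎

  T-two-blocks : ∀ k q q′ x → T q ≡ T q′ → T (suc q) ≡ T (suc q′) → x < 2 ^ k + 2 ^ k →
    T (q * 2 ^ k + x) ≡ T (q′ * 2 ^ k + x)
  T-two-blocks k q q′ x first second x<2a with x <? 2 ^ k
  ... | yes x<a = trans (T-block k q x x<a) (trans (cong (_xor T x) first) (sym (T-block k q′ x x<a)))
  ... | no  x≮a = begin
    T (q * a + x)           ≡⟨ cong (λ x → T (q * a + x)) x≡a+y ⟩
    T (q * a + (a + y))     ≡⟨ cong T (shift q) ⟩
    T (suc q * a + y)       ≡⟨ T-block k (suc q) y y<a ⟩
    T (suc q) xor T y       ≡⟨ cong (_xor T y) second ⟩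
    T (suc q′) xor T y      ≡⟨ T-block k (suc q′) y y<a ⟨
    T (suc q′ * a + y)      ≡⟨ cong T (shift q′) ⟨
    T (q′ * a + (a + y))    ≡⟨ cong (λ x → T (q′ * a + x)) x≡a+y ⟨
    T (q′ * a + x)          ∎
    where
    a = 2 ^ k
    y = x ∸ a
    x≡a+y : x ≡ a + y
    x≡a+y = sym (m+[n∸m]≡n (≮⇒≥ x≮a))
    y<a : y < a
    y<a = +-cancelˡ-< a y a (subst (_< a + a) x≡a+y x<2a)
    shift : ∀ q → q * a + (a + y) ≡ suc q * a + y
    shift q = trans (sym (+-assoc (q * a) a y)) (cong (_+ y) (+-comm (q * a) a))

  two-letter-factors : ∀ q → ∃ λ q′ → q′ ≤ 5 × T q′ ≡ T q × T (suc q′) ≡ T (suc q)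
  two-letter-factors q with T q | T (suc q)
  ... | false | true  = 0 , z≤n , refl , refl
  ... | true  | true  = 1 , s≤s z≤n , refl , refl
  ... | true  | false = 2 , s≤s (s≤s z≤n) , refl , refl
  ... | false | false = 5 , ≤-refl , refl , refl

open ThueMorse
open ≤-Reasoning

double-injective : ∀ {a b} → a + a ≡ b + b → a ≡ b
double-injective {a} {b} a+a≡b+b with <-cmp a b
... | tri< a<b _ _ = ⊥-elim (<-irrefl a+a≡b+b (+-mono-< a<b a<b))
... | tri≈ _ a≡b _ = a≡b
... | tri> _ _ a>b = ⊥-elim (<-irrefl (sym a+a≡b+b) (+-mono-< a>b a>b))

middle-cancel : ∀ {a b c n a′ b′ c′ n′} → a + b + c ≡ n → a′ + b′ + c′ ≡ n′ → a ≡ a′ → c ≡ c′ → n ≡ n′ → b ≡ b′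
middle-cancel {a} {b} {c} {_} {_} {b′} p q refl refl refl =
  +-cancelˡ-≡ a b b′ (+-cancelʳ-≡ c (a + b) (a + b′) (trans p (sym q)))

x+y≡a+l∧y+z≡l⇒x≡a+z : ∀ {x y z a l} → x + y ≡ a + l → y + z ≡ l → x ≡ a + z
x+y≡a+l∧y+z≡l⇒x≡a+z {x} {y} {z} {a} {l} x+y≡a+l y+z≡l = +-cancelʳ-≡ y x (a + z) (begin-equality
  x + y            ≡⟨ x+y≡a+l ⟩
  a + l            ≡⟨ cong (a +_) (trans (sym y+z≡l) (+-comm y z)) ⟩
  a + (z + y)      ≡⟨ +-assoc a z y ⟨
  a + z + y        ∎)

double+1≢double : ∀ a b → suc (a + a) ≢ b + b
double+1≢double zero    zero    ()
double+1≢double zero    (suc b) eq rewrite +-suc b b = 0≢1+n (suc-injective eq)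
double+1≢double (suc a) zero    ()
double+1≢double (suc a) (suc b) eq rewrite +-suc a a | +-suc b b =
  double+1≢double a b (suc-injective (suc-injective eq))

no-parity-step : ∀ {x a b K K′} → x + K ≡ a + a + K′ → suc x + K ≡ b + b + K′ → ⊥
no-parity-step {a = a} {b} {K′ = K′} ex esx =
  double+1≢double a b (+-cancelʳ-≡ K′ _ _ (trans (cong suc (sym ex)) esx))

same-parity-close⇒≡ : ∀ {x y a b K K′} → x + K ≡ a + a + K′ → y + K ≡ b + b + K′ → x ≤ y + 1 → y ≤ x + 1 → x ≡ y
same-parity-close⇒≡ {x} {y} {a} {b} {K} {K′} ex ey x≤y+1 y≤x+1 with <-cmp x y
... | tri≈ _ x≡y _ = x≡y
... | tri< x<y _ _ = ⊥-elim (no-parity-step {x} {a} {b} {K} ex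
  (subst (λ z → z + K ≡ b + b + K′) (≤-antisym (subst (y ≤_) (+-comm x 1) y≤x+1) x<y) ey))
... | tri> _ _ y<x = ⊥-elim (no-parity-step {y} {b} {a} {K} ey
  (subst (λ z → z + K ≡ a + a + K′) (≤-antisym (subst (x ≤_) (+-comm y 1) x≤y+1) y<x) ex))

δ : Bool → Bool → ℕ
δ false false = 1
δ false true  = 0
δ true  false = 0
δ true  true  = 1

δ≤1 : ∀ a b → δ a b ≤ 1
δ≤1 false false = ≤-refl
δ≤1 false true  = z≤n
δ≤1 true  false = z≤n
δ≤1 true  true  = ≤-refl

δ-not≡0 : ∀ a → δ a (not a) ≡ 0
δ-not≡0 false = refl
δ-not≡0 true  = refl

δ-notˡ : ∀ a b → δ (not a) b ≡ 1 ∸ δ a b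
δ-notˡ false false = refl
δ-notˡ false true  = refl
δ-notˡ true  false = refl
δ-notˡ true  true  = refl

δ+δ-not : ∀ a b → δ a b + δ a (not b) ≡ 1
δ+δ-not false false = refl
δ+δ-not false true  = refl
δ+δ-not true  false = refl
δ+δ-not true  true  = refl

windowSum : (ℕ → ℕ) → ℕ → ℕ → ℕ
windowSum f p zero    = 0
windowSum f p (suc L) = f p + windowSum f (suc p) L

windowSum-const : ∀ c p L → windowSum (λ _ → c) p L ≡ L * c
windowSum-const c p zero    = refl
windowSum-const c p (suc L) = cong (c +_) (windowSum-const c (suc p) L)

module _ (f : ℕ → ℕ) where

  windowSum-snoc : ∀ p L → windowSum f p (suc L) ≡ windowSum f p L + f (p + L)
  windowSum-snoc p zero    = trans (+-identityʳ (f p)) (cong f (sym (+-identityʳ p)))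
  windowSum-snoc p (suc L) = begin-equality
    f p + windowSum f (suc p) (suc L)          ≡⟨ cong (f p +_) (windowSum-snoc (suc p) L) ⟩
    f p + (windowSum f (suc p) L + f (suc p + L)) ≡⟨ +-assoc (f p) _ _ ⟨
    f p + windowSum f (suc p) L + f (suc p + L)   ≡⟨ cong (λ i → f p + windowSum f (suc p) L + f i) (+-suc p L) ⟨
    f p + windowSum f (suc p) L + f (p + suc L)   ∎

  windowSum-pairs : ∀ a M → windowSum f (a + a) (M + M) ≡ windowSum (λ j → f (j + j) + f (suc (j + j))) a M
  windowSum-pairs a zero    = refl
  windowSum-pairs a (suc M) rewrite +-suc M M = begin-equality
    f (a + a) + (f (suc (a + a)) + windowSum f (suc (suc (a + a))) (M + M))
      ≡⟨ +-assoc (f (a + a)) _ _ ⟨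
    f (a + a) + f (suc (a + a)) + windowSum f (suc (suc (a + a))) (M + M)
      ≡⟨ cong (λ i → f (a + a) + f (suc (a + a)) + windowSum f i (M + M)) (cong suc (+-suc a a)) ⟨
    f (a + a) + f (suc (a + a)) + windowSum f (suc a + suc a) (M + M)
      ≡⟨ cong (f (a + a) + f (suc (a + a)) +_) (windowSum-pairs (suc a) M) ⟩
    f (a + a) + f (suc (a + a)) + windowSum (λ j → f (j + j) + f (suc (j + j))) (suc a) M ∎

  windowSum-cong : ∀ {g} p L → (∀ i → f i ≡ g i) → windowSum f p L ≡ windowSum g p L
  windowSum-cong p zero    f≗g = refl
  windowSum-cong p (suc L) f≗g = cong₂ _+_ (f≗g p) (windowSum-cong (suc p) L f≗g)

  windowSum-≤suc : ∀ p L → windowSum f p L ≤ windowSum f p (suc L)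
  windowSum-≤suc p L = subst (windowSum f p L ≤_) (sym (windowSum-snoc p L)) (m≤m+n _ _)

  windowSum-suc≤ : (∀ i → f i ≤ 1) → ∀ p L → windowSum f p (suc L) ≤ suc (windowSum f p L)
  windowSum-suc≤ f≤1 p L = begin
    windowSum f p (suc L)          ≡⟨ windowSum-snoc p L ⟩
    windowSum f p L + f (p + L)    ≤⟨ +-monoʳ-≤ (windowSum f p L) (f≤1 (p + L)) ⟩
    windowSum f p L + 1            ≡⟨ +-comm _ 1 ⟩
    suc (windowSum f p L)          ∎

  windowSum-complement : (∀ i → f i ≤ 1) → ∀ p L → windowSum f p L + windowSum (λ i → 1 ∸ f i) p L ≡ L
  windowSum-complement f≤1 p zero    = refl
  windowSum-complement f≤1 p (suc L) = begin-equality
    (f p + windowSum f (suc p) L) + ((1 ∸ f p) + windowSum (λ i → 1 ∸ f i) (suc p) L)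
      ≡⟨ +-interchange (f p) _ (1 ∸ f p) _ ⟩
    (f p + (1 ∸ f p)) + (windowSum f (suc p) L + windowSum (λ i → 1 ∸ f i) (suc p) L)
      ≡⟨ cong₂ _+_ (m+[n∸m]≡n (f≤1 p)) (windowSum-complement f≤1 (suc p) L) ⟩
    suc L ∎

square : ℕ → ℕ
square i = δ (T i) (T (suc i))

change : ℕ → ℕ
change i = 1 ∸ square i

-- squares p L counts the factors 00 and 11 of the factor of length L + 1 at p.
squares : ℕ → ℕ → ℕ
squares = windowSum square

changes : ℕ → ℕ → ℕ
changes = windowSum change

isZero : ℕ → ℕ
isZero i = δ false (T i)

zeros : ℕ → ℕ → ℕ
zeros = windowSum isZero

square≤1 : ∀ i → square i ≤ 1
square≤1 i = δ≤1 (T i) (T (suc i))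

square-double : ∀ j → square (j + j) ≡ 0
square-double j = begin-equality
  δ (T (j + j)) (T (suc (j + j)))  ≡⟨ cong₂ δ (T-double j) (T-double+1 j) ⟩
  δ (T j) (not (T j))              ≡⟨ δ-not≡0 (T j) ⟩
  0                                ∎

square-double+1 : ∀ j → square (suc (j + j)) ≡ change j
square-double+1 j = begin-equality
  δ (T (suc (j + j))) (T (suc (suc (j + j))))  ≡⟨ cong₂ δ (T-double+1 j) (trans (cong (T ∘ suc) (sym (+-suc j j))) (T-double (suc j))) ⟩
  δ (not (T j)) (T (suc j))                    ≡⟨ δ-notˡ (T j) (T (suc j)) ⟩
  change j                                     ∎

squares+changes : ∀ p L → squares p L + changes p L ≡ L
squares+changes = windowSum-complement square square≤1

changes+squares : ∀ a M → changes a M + squares a M ≡ M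
changes+squares a M = trans (+-comm (changes a M) _) (squares+changes a M)

squares-2a-2M : ∀ a M → squares (a + a) (M + M) ≡ changes a M
squares-2a-2M a M = begin-equality
  squares (a + a) (M + M)                                        ≡⟨ windowSum-pairs square a M ⟩
  windowSum (λ j → square (j + j) + square (suc (j + j))) a M   ≡⟨ windowSum-cong (λ j → square (j + j) + square (suc (j + j))) a M (λ j → cong₂ _+_ (square-double j) (square-double+1 j)) ⟩
  changes a M                                                    ∎

squares-2a-2M+1 : ∀ a M → squares (a + a) (suc (M + M)) ≡ changes a M
squares-2a-2M+1 a M = begin-equality
  squares (a + a) (suc (M + M))                    ≡⟨ windowSum-snoc square (a + a) (M + M) ⟩
  squares (a + a) (M + M) + square (a + a + (M + M)) ≡⟨ cong₂ _+_ (squares-2a-2M a M) (trans (cong square (regroup a M)) (square-double (a + M))) ⟩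
  changes a M + 0                                  ≡⟨ +-identityʳ _ ⟩
  changes a M                                      ∎
  where
  regroup : ∀ a M → a + a + (M + M) ≡ (a + M) + (a + M)
  regroup = solve-∀

squares-2a+1-2M : ∀ a M → squares (suc (a + a)) (M + M) ≡ changes a M
squares-2a+1-2M a M = trans (cong (_+ squares (suc (a + a)) (M + M)) (sym (square-double a))) (squares-2a-2M+1 a M)

squares-2a+1-2M+1 : ∀ a M → squares (suc (a + a)) (suc (M + M)) ≡ changes a (suc M)
squares-2a+1-2M+1 a M = begin-equality
  squares (suc (a + a)) (suc (M + M))                        ≡⟨ cong (_+ squares (suc (a + a)) (suc (M + M))) (square-double a) ⟨
  square (a + a) + squares (suc (a + a)) (suc (M + M))       ≡⟨ cong (squares (a + a)) (cong suc (+-suc M M)) ⟨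
  squares (a + a) (suc M + suc M)                            ≡⟨ squares-2a-2M a (suc M) ⟩
  changes a (suc M)                                          ∎

squares-2M : ∀ s M → ∃ λ a → squares s (M + M) ≡ changes a M
squares-2M s M with parity s
... | even a = a , squares-2a-2M a M
... | odd a  = a , squares-2a+1-2M a M

squares-2M+1 : ∀ s M → ∃ λ a → changes a M ≤ squares s (suc (M + M)) × squares s (suc (M + M)) ≤ suc (changes a M)
squares-2M+1 s M with parity s
... | even a rewrite squares-2a-2M+1 a M   = a , ≤-refl , n≤1+n _
... | odd a  rewrite squares-2a+1-2M+1 a M =
  a , windowSum-≤suc change a M , windowSum-suc≤ change (λ i → m∸n≤m 1 (square i)) a M

Spread : (ℕ → ℕ) → ℕ → Set
Spread f d = ∀ p q → f p ≤ f q + d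

spread-weaken : ∀ {f d d'} → d ≤ d' → Spread f d → Spread f d'
spread-weaken d≤d' spr p q = ≤-trans (spr p q) (+-monoʳ-≤ _ d≤d')

changes-spread : ∀ M {d} → Spread (λ s → squares s M) d → Spread (λ a → changes a M) d
changes-spread M {d} spr a b = +-cancelˡ-≤ (squares a M) _ _ (begin
  squares a M + changes a M        ≡⟨ trans (squares+changes a M) (sym (squares+changes b M)) ⟩
  squares b M + changes b M        ≤⟨ +-monoˡ-≤ (changes b M) (spr b a) ⟩
  squares a M + d + changes b M    ≡⟨ +-assoc (squares a M) d _ ⟩
  squares a M + (d + changes b M)  ≡⟨ cong (squares a M +_) (+-comm d _) ⟩
  squares a M + (changes b M + d)  ∎)

squareSpread-double : ∀ M {d} → Spread (λ s → squares s M) d → Spread (λ s → squares s (M + M)) d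
squareSpread-double M {d} spr s s'
  with a , eq ← squares-2M s M | a' , eq' ← squares-2M s' M = begin
  squares s (M + M)       ≡⟨ eq ⟩
  changes a M             ≤⟨ changes-spread M spr a a' ⟩
  changes a' M + d        ≡⟨ cong (_+ d) eq' ⟨
  squares s' (M + M) + d  ∎

squareSpread-double+1 : ∀ M {d} → Spread (λ s → squares s M) d → Spread (λ s → squares s (suc (M + M))) (suc d)
squareSpread-double+1 M {d} spr s s'
  with a , _ , upper ← squares-2M+1 s M | a' , lower , _ ← squares-2M+1 s' M = begin
  squares s (suc (M + M))         ≤⟨ upper ⟩
  suc (changes a M)               ≤⟨ s≤s (changes-spread M spr a a') ⟩
  suc (changes a' M + d)          ≤⟨ s≤s (+-monoˡ-≤ d lower) ⟩
  suc (squares s' (suc (M + M)) + d) ≡⟨ +-suc _ d ⟨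
  squares s' (suc (M + M)) + suc d ∎

squareSpread-log : ∀ k L → L < 2 ^ k → Spread (λ s → squares s L) k
squareSpread-log zero    zero    _        _ _ = z≤n
squareSpread-log zero    (suc L) (s≤s ())
squareSpread-log (suc k) L       L<2^k+1 with parity L
... | even M = spread-weaken (n≤1+n k)
  (squareSpread-double M (squareSpread-log k M (double-cancel-< (subst (M + M <_) (2^-suc k) L<2^k+1))))
... | odd M  = squareSpread-double+1 M
  (squareSpread-log k M (double+1-cancel-< (subst (suc (M + M) <_) (2^-suc k) L<2^k+1)))

squareSpread-2^ : ∀ m → Spread (λ s → squares s (2 ^ m)) 1
squareSpread-2^ zero    = squareSpread-double+1 0 {0} (λ _ _ → z≤n)
squareSpread-2^ (suc m) = subst (λ L → Spread (λ s → squares s L) 1) (sym (2^-suc m))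
  (squareSpread-double (2 ^ m) (squareSpread-2^ m))

zero-pair : ∀ j → isZero (j + j) + isZero (suc (j + j)) ≡ 1
zero-pair j rewrite T-double j | T-double+1 j = δ+δ-not false (T j)

zeros-2a-2M : ∀ a M → zeros (a + a) (M + M) ≡ M
zeros-2a-2M a M = begin-equality
  zeros (a + a) (M + M)     ≡⟨ windowSum-pairs isZero a M ⟩
  windowSum _ a M           ≡⟨ windowSum-cong (λ j → isZero (j + j) + isZero (suc (j + j))) a M zero-pair ⟩
  windowSum (λ _ → 1) a M   ≡⟨ windowSum-const 1 a M ⟩
  M * 1                     ≡⟨ *-identityʳ M ⟩
  M                         ∎

zeros-even-balanced : ∀ a n → zeros (a + a) n + zeros (a + a) n ≤ n + 1 × n ≤ zeros (a + a) n + zeros (a + a) n + 1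
zeros-even-balanced a n with parity n
... | even M rewrite zeros-2a-2M a M = m≤m+n _ 1 , m≤m+n _ 1
... | odd M = (begin
  z + z                ≡⟨ cong₂ _+_ z≡M+t z≡M+t ⟩
  (M + t) + (M + t)    ≤⟨ +-mono-≤ (+-monoʳ-≤ M t≤1) (+-monoʳ-≤ M t≤1) ⟩
  (M + 1) + (M + 1)    ≡⟨ regroup M ⟩
  suc (M + M) + 1      ∎) , (begin
  suc (M + M)          ≡⟨ +-comm 1 (M + M) ⟩
  M + M + 1            ≤⟨ +-monoˡ-≤ 1 (+-mono-≤ (m≤m+n M t) (m≤m+n M t)) ⟩
  (M + t) + (M + t) + 1 ≡⟨ cong (_+ 1) (cong₂ _+_ z≡M+t z≡M+t) ⟨
  z + z + 1            ∎)
  where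
  z = zeros (a + a) (suc (M + M))
  t = isZero (a + a + (M + M))
  t≤1 = δ≤1 false (T (a + a + (M + M)))
  z≡M+t : z ≡ M + t
  z≡M+t = trans (windowSum-snoc isZero (a + a) (M + M)) (cong (_+ t) (zeros-2a-2M a M))
  regroup : ∀ M → (M + 1) + (M + 1) ≡ suc (M + M) + 1
  regroup = solve-∀

zeros-balanced : ∀ p n → zeros p n + zeros p n ≤ n + 2 × n ≤ zeros p n + zeros p n + 2
zeros-balanced p n with parity p
... | even a with upper , lower ← zeros-even-balanced a n = ≤-trans upper (+-monoʳ-≤ n (n≤1+n 1)) , ≤-trans lower (+-monoʳ-≤ _ (n≤1+n 1))
... | odd a with upper , lower ← zeros-even-balanced a (suc n) = (begin
  z + z                ≤⟨ +-mono-≤ (m≤n+m z t) (m≤n+m z t) ⟩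
  (t + z) + (t + z)    ≤⟨ upper ⟩
  suc n + 1            ≡⟨ +-suc n 1 ⟨
  n + 2                ∎) , +-cancelʳ-≤ 1 n (z + z + 2) (begin
  n + 1                ≡⟨ +-comm n 1 ⟩
  suc n                ≤⟨ lower ⟩
  (t + z) + (t + z) + 1 ≤⟨ +-monoˡ-≤ 1 (+-mono-≤ (+-monoˡ-≤ z t≤1) (+-monoˡ-≤ z t≤1)) ⟩
  (1 + z) + (1 + z) + 1 ≡⟨ regroup z ⟩
  z + z + 2 + 1        ∎)
  where
  z = zeros (suc (a + a)) n
  t = isZero (a + a)
  t≤1 = δ≤1 false (T (a + a))
  regroup : ∀ z → (1 + z) + (1 + z) + 1 ≡ z + z + 2 + 1
  regroup = solve-∀

zeros-spread : ∀ n → Spread (λ p → zeros p n) 2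
zeros-spread n p q = s≤s⁻¹ (double-cancel-< (begin-strict
  zeros p n + zeros p n           ≤⟨ proj₁ (zeros-balanced p n) ⟩
  n + 2                           ≤⟨ +-monoˡ-≤ 2 (proj₂ (zeros-balanced q n)) ⟩
  zeros q n + zeros q n + 2 + 2   <⟨ m<m+n _ {2} z<s ⟩
  zeros q n + zeros q n + 2 + 2 + 2 ≡⟨ regroup (zeros q n) ⟩
  suc (zeros q n + 2) + suc (zeros q n + 2) ∎))
  where
  regroup : ∀ z → z + z + 2 + 2 + 2 ≡ suc (z + 2) + suc (z + 2)
  regroup = solve-∀

zeros-2h+1 : ∀ h p → h ≤ zeros p (suc (h + h)) × zeros p (suc (h + h)) ≤ suc h
zeros-2h+1 h p with upper , lower ← zeros-balanced p (suc (h + h)) = s≤s⁻¹ (double-cancel-< (begin-strict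
  h + h                 <⟨ n<1+n _ ⟩
  suc (h + h)           ≤⟨ lower ⟩
  z + z + 2             ≡⟨ regroup₁ z ⟩
  suc z + suc z         ∎)) , s≤s⁻¹ (double-cancel-< (begin-strict
  z + z                 ≤⟨ upper ⟩
  suc (h + h) + 2       <⟨ n<1+n _ ⟩
  suc (suc (h + h) + 2) ≡⟨ regroup₂ h ⟩
  suc (suc h) + suc (suc h) ∎))
  where
  z = zeros p (suc (h + h))
  regroup₁ : ∀ z → z + z + 2 ≡ suc z + suc z
  regroup₁ = solve-∀
  regroup₂ : ∀ h → suc (suc (h + h) + 2) ≡ suc (suc h) + suc (suc h)
  regroup₂ = solve-∀

-- c₄ m = (4^m − 1)/3; windows of length ℓ₄ m = 2 c₄ m + 1 carry factors of length (2·4^m + 4)/3.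
c₄ : ℕ → ℕ
c₄ zero    = 0
c₄ (suc m) = suc ((c₄ m + c₄ m) + (c₄ m + c₄ m))

ℓ₄ : ℕ → ℕ
ℓ₄ m = suc (c₄ m + c₄ m)

3*c₄+1≡4^ : ∀ m → 3 * c₄ m + 1 ≡ 4 ^ m
3*c₄+1≡4^ zero    = refl
3*c₄+1≡4^ (suc m) = trans (regroup (c₄ m)) (cong (4 *_) (3*c₄+1≡4^ m))
  where
  regroup : ∀ c → 3 * suc ((c + c) + (c + c)) + 1 ≡ 4 * (3 * c + 1)
  regroup = solve-∀

[2*4^m+4]/3≡1+ℓ₄ : ∀ m → (2 * 4 ^ m + 4) / 3 ≡ suc (ℓ₄ m)
[2*4^m+4]/3≡1+ℓ₄ m = begin-equality
  (2 * 4 ^ m + 4) / 3                  ≡⟨ cong (λ x → (2 * x + 4) / 3) (3*c₄+1≡4^ m) ⟨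
  (2 * (3 * c₄ m + 1) + 4) / 3         ≡⟨ cong (_/ 3) (regroup (c₄ m)) ⟩
  suc (ℓ₄ m) * 3 / 3                   ≡⟨ m*n/n≡m (suc (ℓ₄ m)) 3 ⟩
  suc (ℓ₄ m)                           ∎
  where
  regroup : ∀ c → 2 * (3 * c + 1) + 4 ≡ suc (suc (c + c)) * 3
  regroup = solve-∀

ℓ₄<2^[1+2m] : ∀ m → ℓ₄ m < 2 ^ suc (m + m)
ℓ₄<2^[1+2m] m = begin-strict
  suc (c + c)                          <⟨ m<m+n _ {c + c + (c + c) + 1} 0<4c+2 ⟩
  suc (c + c) + (c + c + (c + c) + 1)  ≡⟨ regroup c ⟩
  2 * (3 * c + 1)                      ≡⟨ cong (2 *_) (3*c₄+1≡4^ m) ⟩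
  2 * 4 ^ m                            ≡⟨ cong (2 *_) (^-*-assoc 2 2 m) ⟩
  2 * 2 ^ (2 * m)                      ≡⟨ cong (λ e → 2 * 2 ^ (m + e)) (+-identityʳ m) ⟩
  2 ^ suc (m + m)                      ∎
  where
  c = c₄ m
  0<4c+2 : 0 < c + c + (c + c) + 1
  0<4c+2 = subst (0 <_) (+-comm 1 _) z<s
  regroup : ∀ c → suc (c + c) + (c + c + (c + c) + 1) ≡ 2 * (3 * c + 1)
  regroup = solve-∀

squares-lift-even : ∀ m b → let b′ = suc (b + b) in
  squares (b′ + b′) (ℓ₄ (suc m)) ≡ (c₄ m + c₄ m) + squares b (ℓ₄ m)
squares-lift-even m b = x+y≡a+l∧y+z≡l⇒x≡a+z
  (begin-equality
    squares (b′ + b′) (suc (M′ + M′)) + changes b (suc C)  ≡⟨ cong₂ _+_ (squares-2a-2M+1 b′ M′) (sym (squares-2a+1-2M+1 b C)) ⟩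
    changes b′ M′ + squares b′ M′                          ≡⟨ changes+squares b′ M′ ⟩
    M′                                                     ≡⟨ +-suc C C ⟨
    C + suc C                                              ∎)
  (changes+squares b (suc C))
  where
  b′ = suc (b + b)
  C  = c₄ m + c₄ m
  M′ = c₄ (suc m)

squares-lift-odd : ∀ m b → let b′ = b + b in
  squares (suc (b′ + b′)) (ℓ₄ (suc m)) ≡ suc ((c₄ m + c₄ m) + squares b (ℓ₄ m))
squares-lift-odd m b = x+y≡a+l∧y+z≡l⇒x≡a+z
  (begin-equality
    squares (suc (b′ + b′)) (suc (M′ + M′)) + changes b (suc C)  ≡⟨ cong₂ _+_ (squares-2a+1-2M+1 b′ M′) (sym (trans (cong (λ L → squares b′ L) (sym (cong suc (+-suc C C)))) (squares-2a-2M b (suc C)))) ⟩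
    changes b′ (suc M′) + squares b′ (suc M′)                   ≡⟨ changes+squares b′ (suc M′) ⟩
    suc M′                                                      ≡⟨ cong suc (+-suc C C) ⟨
    suc C + suc C                                               ∎)
  (changes+squares b (suc C))
  where
  b′ = b + b
  C  = c₄ m + c₄ m
  M′ = c₄ (suc m)

-- Each level doubles the window twice and adds one new value to the range of squares.
squares-spectrum : ∀ m → ∃ λ base → ∀ j → j ≤ m → ∃ λ s → squares s (ℓ₄ m) ≡ base + j
squares-spectrum zero = squares 0 1 , λ { zero z≤n → 0 , sym (+-identityʳ _) }
squares-spectrum (suc m) with base , family ← squares-spectrum m = C + base , family′
  where
  C = c₄ m + c₄ m
  family′ : ∀ j → j ≤ suc m → ∃ λ s → squares s (ℓ₄ (suc m)) ≡ C + base + j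
  family′ zero _ with b , eq ← family zero z≤n =
    suc (b + b) + suc (b + b) , (begin-equality
      squares (suc (b + b) + suc (b + b)) (ℓ₄ (suc m))  ≡⟨ squares-lift-even m b ⟩
      C + squares b (ℓ₄ m)                             ≡⟨ cong (C +_) (trans eq (+-identityʳ base)) ⟩
      C + base                                         ≡⟨ +-identityʳ _ ⟨
      C + base + 0                                     ∎)
  family′ (suc j) (s≤s j≤m) with b , eq ← family j j≤m =
    suc ((b + b) + (b + b)) , (begin-equality
      squares (suc ((b + b) + (b + b))) (ℓ₄ (suc m))   ≡⟨ squares-lift-odd m b ⟩
      suc (C + squares b (ℓ₄ m))                       ≡⟨ cong (λ x → suc (C + x)) eq ⟩
      suc (C + (base + j))                             ≡⟨ cong suc (+-assoc C base j) ⟨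
      suc (C + base + j)                               ≡⟨ +-suc _ j ⟨
      C + base + suc j                                 ∎)

#₁ : Bool → List Bool → ℕ
#₁ a = occ (a ∷ [])

#₂ : Bool → Bool → List Bool → ℕ
#₂ a b = occ (a ∷ b ∷ [])

δ₂ : Bool → Bool → Bool → Bool → ℕ
δ₂ a b x y = if isPrefix (a ∷ b ∷ []) (x ∷ y ∷ []) then 1 else 0

last∷ : Bool → List Bool → Bool
last∷ x []      = x
last∷ _ (y ∷ u) = last∷ y u

#₁-∷ : ∀ a x u → #₁ a (x ∷ u) ≡ δ a x + #₁ a u
#₁-∷ false false u = refl
#₁-∷ false true  u = refl
#₁-∷ true  false u = refl
#₁-∷ true  true  u = refl

#₁-total : ∀ u → #₁ false u + #₁ true u ≡ length u
#₁-total []          = refl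
#₁-total (false ∷ u) = cong suc (#₁-total u)
#₁-total (true ∷ u)  = trans (+-suc _ _) (cong suc (#₁-total u))

δ₂-sumʳ : ∀ a x y → δ₂ a false x y + δ₂ a true x y ≡ δ a x
δ₂-sumʳ false false false = refl
δ₂-sumʳ false false true  = refl
δ₂-sumʳ false true  false = refl
δ₂-sumʳ false true  true  = refl
δ₂-sumʳ true  false false = refl
δ₂-sumʳ true  false true  = refl
δ₂-sumʳ true  true  false = refl
δ₂-sumʳ true  true  true  = refl

δ₂-sumˡ : ∀ b x y → δ₂ false b x y + δ₂ true b x y ≡ δ b y
δ₂-sumˡ false false false = refl
δ₂-sumˡ false false true  = refl
δ₂-sumˡ false true  false = refl
δ₂-sumˡ false true  true  = refl
δ₂-sumˡ true  false false = refl
δ₂-sumˡ true  false true  = refl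
δ₂-sumˡ true  true  false = refl
δ₂-sumˡ true  true  true  = refl

#₂-followers : ∀ a x u → #₂ a false (x ∷ u) + #₂ a true (x ∷ u) + δ a (last∷ x u) ≡ #₁ a (x ∷ u)
#₂-followers false false []      = refl
#₂-followers false true  []      = refl
#₂-followers true  false []      = refl
#₂-followers true  true  []      = refl
#₂-followers a     x     (y ∷ u) = begin-equality
  (δ₂ a false x y + #₂ a false (y ∷ u)) + (δ₂ a true x y + #₂ a true (y ∷ u)) + δ a (last∷ y u)
    ≡⟨ regroup (δ₂ a false x y) _ (δ₂ a true x y) _ _ ⟩
  (δ₂ a false x y + δ₂ a true x y) + (#₂ a false (y ∷ u) + #₂ a true (y ∷ u) + δ a (last∷ y u))
    ≡⟨ cong₂ _+_ (δ₂-sumʳ a x y) (#₂-followers a y u) ⟩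
  δ a x + #₁ a (y ∷ u)
    ≡⟨ #₁-∷ a x (y ∷ u) ⟨
  #₁ a (x ∷ y ∷ u) ∎
  where
  regroup : ∀ p A q B d → (p + A) + (q + B) + d ≡ (p + q) + (A + B + d)
  regroup = solve-∀

#₂-predecessors : ∀ b x u → #₂ false b (x ∷ u) + #₂ true b (x ∷ u) + δ b x ≡ #₁ b (x ∷ u)
#₂-predecessors false false []      = refl
#₂-predecessors false true  []      = refl
#₂-predecessors true  false []      = refl
#₂-predecessors true  true  []      = refl
#₂-predecessors b     x     (y ∷ u) = begin-equality
  (δ₂ false b x y + #₂ false b (y ∷ u)) + (δ₂ true b x y + #₂ true b (y ∷ u)) + δ b x
    ≡⟨ regroup (δ₂ false b x y) _ (δ₂ true b x y) _ _ ⟩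
  δ b x + (#₂ false b (y ∷ u) + #₂ true b (y ∷ u) + (δ₂ false b x y + δ₂ true b x y))
    ≡⟨ cong (λ d → δ b x + (#₂ false b (y ∷ u) + #₂ true b (y ∷ u) + d)) (δ₂-sumˡ b x y) ⟩
  δ b x + (#₂ false b (y ∷ u) + #₂ true b (y ∷ u) + δ b y)
    ≡⟨ cong (δ b x +_) (#₂-predecessors b y u) ⟩
  δ b x + #₁ b (y ∷ u)
    ≡⟨ #₁-∷ b x (y ∷ u) ⟨
  #₁ b (x ∷ y ∷ u) ∎
  where
  regroup : ∀ p A q B d → (p + A) + (q + B) + d ≡ d + (A + B + (p + q))
  regroup = solve-∀

squareCount : List Bool → ℕ
squareCount w = #₂ false false w + #₂ true true w

squareCount-balance : ∀ x u → let w = x ∷ u in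
  squareCount w + δ true x + #₁ false w ≡ (#₂ false false w + #₂ false false w) + #₁ true w + δ false (last∷ x u)
squareCount-balance x u = begin-equality
  c₀₀ + c₁₁ + δ true x + #₁ false w                    ≡⟨ cong (c₀₀ + c₁₁ + δ true x +_) (#₂-followers false x u) ⟨
  c₀₀ + c₁₁ + δ true x + (c₀₀ + c₀₁ + δ false ℓ)       ≡⟨ regroup c₀₀ c₁₁ (δ true x) c₀₁ (δ false ℓ) ⟩
  (c₀₀ + c₀₀) + (c₀₁ + c₁₁ + δ true x) + δ false ℓ     ≡⟨ cong (λ n₁ → (c₀₀ + c₀₀) + n₁ + δ false ℓ) (#₂-predecessors true x u) ⟩
  (c₀₀ + c₀₀) + #₁ true w + δ false ℓ                  ∎
  where
  w   = x ∷ u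
  ℓ   = last∷ x u
  c₀₀ = #₂ false false w
  c₀₁ = #₂ false true w
  c₁₁ = #₂ true true w
  regroup : ∀ a b e c d → a + b + e + (a + c + d) ≡ (a + a) + (c + b + e) + d
  regroup = solve-∀

SameCounts : List Bool → List Bool → Set
SameCounts u v = #₁ false u ≡ #₁ false v × #₁ true u ≡ #₁ true v
               × #₂ false false u ≡ #₂ false false v × #₂ false true u ≡ #₂ false true v
               × #₂ true false u ≡ #₂ true false v × #₂ true true u ≡ #₂ true true v

sameCounts⇒≈₂ : ∀ u v → SameCounts u v → u ≈₂ v
sameCounts⇒≈₂ _ _ (e₀ , _ , _ , _ , _ , _)   (false ∷ [])         _ _ = e₀
sameCounts⇒≈₂ _ _ (_ , e₁ , _ , _ , _ , _)   (true ∷ [])          _ _ = e₁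
sameCounts⇒≈₂ _ _ (_ , _ , e₀₀ , _ , _ , _)  (false ∷ false ∷ []) _ _ = e₀₀
sameCounts⇒≈₂ _ _ (_ , _ , _ , e₀₁ , _ , _)  (false ∷ true ∷ [])  _ _ = e₀₁
sameCounts⇒≈₂ _ _ (_ , _ , _ , _ , e₁₀ , _)  (true ∷ false ∷ [])  _ _ = e₁₀
sameCounts⇒≈₂ _ _ (_ , _ , _ , _ , _ , e₁₁)  (true ∷ true ∷ [])   _ _ = e₁₁
sameCounts⇒≈₂ _ _ _ (_ ∷ _ ∷ _ ∷ _) _ (s≤s (s≤s ()))

≈₂⇒sameCounts : ∀ u v → u ≈₂ v → SameCounts u v
≈₂⇒sameCounts _ _ u≈v = one false , one true , two false false , two false true , two true false , two true true
  where
  one = λ a → u≈v (a ∷ []) (s≤s z≤n) (s≤s z≤n)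
  two = λ a b → u≈v (a ∷ b ∷ []) (s≤s z≤n) (s≤s (s≤s z≤n))

≈₂? : Decidable _≈₂_
≈₂? u v = map′ (sameCounts⇒≈₂ u v) (≈₂⇒sameCounts u v)
  (#₁ false u ≟ #₁ false v ×-dec #₁ true u ≟ #₁ true v
    ×-dec #₂ false false u ≟ #₂ false false v ×-dec #₂ false true u ≟ #₂ false true v
    ×-dec #₂ true false u ≟ #₂ true false v ×-dec #₂ true true u ≟ #₂ true true v)

≈₂-isDecEquivalence : IsDecEquivalence _≈₂_
≈₂-isDecEquivalence = record
  { isEquivalence = record
    { refl  = λ _ _ _ → refl
    ; sym   = λ u≈v w p q → sym (u≈v w p q)
    ; trans = λ u≈v v≈w w p q → trans (u≈v w p q) (v≈w w p q)
    }
  ; _≟_ = ≈₂?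
  }

≈₂-determined : ∀ {x y u v} → x ≡ y → length u ≡ length v → last∷ x u ≡ last∷ y v →
  #₁ false (x ∷ u) ≡ #₁ false (y ∷ v) → squareCount (x ∷ u) ≡ squareCount (y ∷ v) → (x ∷ u) ≈₂ (y ∷ v)
≈₂-determined {x} {_} {u} {v} refl |u|≡|v| ℓ≡ℓ′ e₀ eQ = sameCounts⇒≈₂ (x ∷ u) (x ∷ v) (e₀ , e₁ , e₀₀ , e₀₁ , e₁₀ , e₁₁)
  where
  e₁ : #₁ true (x ∷ u) ≡ #₁ true (x ∷ v)
  e₁ = +-cancelˡ-≡ (#₁ false (x ∷ u)) _ _ (begin-equality
    #₁ false (x ∷ u) + #₁ true (x ∷ u) ≡⟨ #₁-total (x ∷ u) ⟩
    suc (length u)                     ≡⟨ cong suc |u|≡|v| ⟩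
    suc (length v)                     ≡⟨ #₁-total (x ∷ v) ⟨
    #₁ false (x ∷ v) + #₁ true (x ∷ v) ≡⟨ cong (_+ #₁ true (x ∷ v)) e₀ ⟨
    #₁ false (x ∷ u) + #₁ true (x ∷ v) ∎)
  e₀₀ : #₂ false false (x ∷ u) ≡ #₂ false false (x ∷ v)
  e₀₀ = double-injective (+-cancelʳ-≡ (#₁ true (x ∷ u) + δ false (last∷ x u)) _ _ (begin-equality
    c₀₀ u + c₀₀ u + (#₁ true (x ∷ u) + δ false (last∷ x u))  ≡⟨ +-assoc (c₀₀ u + c₀₀ u) _ _ ⟨
    c₀₀ u + c₀₀ u + #₁ true (x ∷ u) + δ false (last∷ x u)    ≡⟨ squareCount-balance x u ⟨
    squareCount (x ∷ u) + δ true x + #₁ false (x ∷ u)        ≡⟨ cong₂ (λ Q n₀ → Q + δ true x + n₀) eQ e₀ ⟩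
    squareCount (x ∷ v) + δ true x + #₁ false (x ∷ v)        ≡⟨ squareCount-balance x v ⟩
    c₀₀ v + c₀₀ v + #₁ true (x ∷ v) + δ false (last∷ x v)    ≡⟨ +-assoc (c₀₀ v + c₀₀ v) _ _ ⟩
    c₀₀ v + c₀₀ v + (#₁ true (x ∷ v) + δ false (last∷ x v))  ≡⟨ cong₂ (λ n₁ ℓ → c₀₀ v + c₀₀ v + (n₁ + δ false ℓ)) e₁ ℓ≡ℓ′ ⟨
    c₀₀ v + c₀₀ v + (#₁ true (x ∷ u) + δ false (last∷ x u))  ∎))
    where
    c₀₀ = λ w → #₂ false false (x ∷ w)
  e₁₁ : #₂ true true (x ∷ u) ≡ #₂ true true (x ∷ v)
  e₁₁ = +-cancelˡ-≡ (#₂ false false (x ∷ u)) _ _ (trans eQ (cong (_+ #₂ true true (x ∷ v)) (sym e₀₀)))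
  e₀₁ : #₂ false true (x ∷ u) ≡ #₂ false true (x ∷ v)
  e₀₁ = middle-cancel (#₂-followers false x u) (#₂-followers false x v) e₀₀ (cong (δ false) ℓ≡ℓ′) e₀
  e₁₀ : #₂ true false (x ∷ u) ≡ #₂ true false (x ∷ v)
  e₁₀ = middle-cancel (#₂-predecessors false x u) (#₂-predecessors false x v) e₀₀ refl e₀

squareCount-parity : ∀ x u → let w = x ∷ u in
  squareCount w + δ true x + (#₁ false w + #₁ false w) ≡ (#₂ false false w + #₂ false false w) + (length w + δ false (last∷ x u))
squareCount-parity x u = begin-equality
  Q + δ true x + (n₀ + n₀)       ≡⟨ +-assoc (Q + δ true x) n₀ n₀ ⟨
  Q + δ true x + n₀ + n₀         ≡⟨ cong (_+ n₀) (squareCount-balance x u) ⟩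
  c₀₀ + c₀₀ + n₁ + d + n₀        ≡⟨ regroup (c₀₀ + c₀₀) n₁ d n₀ ⟩
  c₀₀ + c₀₀ + (n₀ + n₁ + d)      ≡⟨ cong (λ n → c₀₀ + c₀₀ + (n + d)) (#₁-total w) ⟩
  c₀₀ + c₀₀ + (length w + d)     ∎
  where
  w   = x ∷ u
  Q   = squareCount w
  n₀  = #₁ false w
  n₁  = #₁ true w
  c₀₀ = #₂ false false w
  d   = δ false (last∷ x u)
  regroup : ∀ a b c e → a + b + c + e ≡ a + (e + b + c)
  regroup = solve-∀

factor-∷ : ∀ p n → factor p (suc n) ≡ T p ∷ factor (suc p) n
factor-∷ p n = cong₂ _∷_ (cong T (+-identityʳ p)) (trans (cong (map (λ j → T (p + j))) (sym (map-upTo suc n)))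
  (trans (sym (map-∘ (upTo n))) (map-cong (λ j → cong T (+-suc p j)) (upTo n))))

factor-cong : ∀ p q n → (∀ j → j < n → T (p + j) ≡ T (q + j)) → factor p n ≡ factor q n
factor-cong p q n agree = map-cong-local (All.tabulate (λ j∈upTo → agree _ (∈-upTo⁻ j∈upTo)))

length-factor : ∀ p n → length (factor p n) ≡ n
length-factor p n = trans (length-map _ (upTo n)) (length-upTo n)

last-factor : ∀ p L → last∷ (T p) (factor (suc p) L) ≡ T (p + L)
last-factor p zero    = cong T (sym (+-identityʳ p))
last-factor p (suc L) = trans (cong (last∷ (T p)) (factor-∷ (suc p) L))
  (trans (last-factor (suc p) L) (cong T (sym (+-suc p L))))

#₁-false-factor : ∀ p n → #₁ false (factor p n) ≡ zeros p n
#₁-false-factor p zero    = refl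
#₁-false-factor p (suc n) = begin-equality
  #₁ false (factor p (suc n))                   ≡⟨ cong (#₁ false) (factor-∷ p n) ⟩
  #₁ false (T p ∷ factor (suc p) n)             ≡⟨ #₁-∷ false (T p) (factor (suc p) n) ⟩
  isZero p + #₁ false (factor (suc p) n)        ≡⟨ cong (isZero p +_) (#₁-false-factor (suc p) n) ⟩
  zeros p (suc n)                               ∎

squareCount-[_] : ∀ x → squareCount (x ∷ []) ≡ 0
squareCount-[ false ] = refl
squareCount-[ true ]  = refl

δ₂-squares : ∀ x y → δ₂ false false x y + δ₂ true true x y ≡ δ x y
δ₂-squares false false = refl
δ₂-squares false true  = refl
δ₂-squares true  false = refl
δ₂-squares true  true  = refl

squareCount-factor : ∀ p L → squareCount (factor p (suc L)) ≡ squares p L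
squareCount-factor p zero    = trans (cong squareCount (factor-∷ p 0)) squareCount-[ T p ]
squareCount-factor p (suc L) = begin-equality
  squareCount (factor p (suc (suc L)))
    ≡⟨ cong squareCount (trans (factor-∷ p (suc L)) (cong (T p ∷_) (factor-∷ (suc p) L))) ⟩
  (δ₂ false false x y + #₂ false false (y ∷ r)) + (δ₂ true true x y + #₂ true true (y ∷ r))
    ≡⟨ +-interchange (δ₂ false false x y) _ (δ₂ true true x y) _ ⟩
  (δ₂ false false x y + δ₂ true true x y) + squareCount (y ∷ r)
    ≡⟨ cong₂ _+_ (δ₂-squares x y) (trans (cong squareCount (sym (factor-∷ (suc p) L))) (squareCount-factor (suc p) L)) ⟩
  square p + squares (suc p) L ∎
  where
  x = T p
  y = T (suc p)
  r = factor (suc (suc p)) L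

module _ (p L : ℕ) where

  private
    w : List Bool
    w = T p ∷ factor (suc p) L

  squareCount-window : squareCount w ≡ squares p L
  squareCount-window = trans (cong squareCount (sym (factor-∷ p L))) (squareCount-factor p L)

  #₁-false-window : #₁ false w ≡ zeros p (suc L)
  #₁-false-window = trans (cong (#₁ false) (sym (factor-∷ p L))) (#₁-false-factor p (suc L))

  squares-parity : ∃ λ A → squares p L + (δ true (T p) + (zeros p (suc L) + zeros p (suc L)))
                         ≡ A + A + (suc L + δ false (T (p + L)))
  squares-parity = #₂ false false w , (begin-equality
    squares p L + (δ true (T p) + (zeros p (suc L) + zeros p (suc L)))
      ≡⟨ +-assoc (squares p L) _ _ ⟨
    squares p L + δ true (T p) + (zeros p (suc L) + zeros p (suc L))
      ≡⟨ cong₂ (λ Q n₀ → Q + δ true (T p) + (n₀ + n₀)) squareCount-window #₁-false-window ⟨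
    squareCount w + δ true (T p) + (#₁ false w + #₁ false w)
      ≡⟨ squareCount-parity (T p) (factor (suc p) L) ⟩
    c₀₀ + c₀₀ + (suc (length (factor (suc p) L)) + δ false (last∷ (T p) (factor (suc p) L)))
      ≡⟨ cong₂ (λ n ℓ → c₀₀ + c₀₀ + (suc n + δ false ℓ)) (length-factor (suc p) L) (last-factor p L) ⟩
    c₀₀ + c₀₀ + (suc L + δ false (T (p + L))) ∎)
    where
    c₀₀ = #₂ false false w

≈₂-window : ∀ p q L → T p ≡ T q → T (p + L) ≡ T (q + L) → zeros p (suc L) ≡ zeros q (suc L) →
  squares p L ≡ squares q L → factor p (suc L) ≈₂ factor q (suc L)
≈₂-window p q L first last z s = subst₂ _≈₂_ (sym (factor-∷ p L)) (sym (factor-∷ q L)) (≈₂-determined first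
  (trans (length-factor (suc p) L) (sym (length-factor (suc q) L)))
  (trans (last-factor p L) (trans last (sym (last-factor q L))))
  (trans (#₁-false-window p L) (trans z (sym (#₁-false-window q L))))
  (trans (squareCount-window p L) (trans s (sym (squareCount-window q L)))))

squares-invariant : ∀ p q L → factor p (suc L) ≈₂ factor q (suc L) → squares p L ≡ squares q L
squares-invariant p q L u≈v = begin-equality
  squares p L                                                  ≡⟨ squareCount-factor p L ⟨
  squareCount (factor p (suc L))                               ≡⟨ cong₂ _+_ (u≈v (false ∷ false ∷ []) (s≤s z≤n) (s≤s (s≤s z≤n)))
                                                                            (u≈v (true ∷ true ∷ []) (s≤s z≤n) (s≤s (s≤s z≤n))) ⟩
  squareCount (factor q (suc L))                               ≡⟨ squareCount-factor q L ⟩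
  squares q L                                                  ∎

-- Write p = q 2^n + r with r < 2^n: the factor lies in T(q) T(q+1) blown up by τ^n,
-- and the two-letter factor T(q) T(q+1) already occurs at some q′ ≤ 5.
factor-recurrence : ∀ n p → ∃ λ p′ → p′ < 6 * 2 ^ n × factor p n ≡ factor p′ n
factor-recurrence n p = shifted (two-letter-factors q)
  where
  d = 2 ^ n
  instance
    d≢0 : NonZero d
    d≢0 = m^n≢0 2 n
  q = p / d
  r = p % d
  r<d : r < d
  r<d = m%n<n p d
  shifted : (∃ λ q′ → q′ ≤ 5 × T q′ ≡ T q × T (suc q′) ≡ T (suc q)) → ∃ λ p′ → p′ < 6 * d × factor p n ≡ factor p′ n
  shifted (q′ , q′≤5 , first , second) = q′ * d + r , p′<6d , factor-cong p (q′ * d + r) n agree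
    where
    agree : ∀ j → j < n → T (p + j) ≡ T (q′ * d + r + j)
    agree j j<n = trans (cong T p+j≡qd+[r+j])
      (trans (T-two-blocks n q q′ (r + j) (sym first) (sym second) r+j<2d) (cong T (sym (+-assoc (q′ * d) r j))))
      where
      r+j<2d = +-mono-<-≤ r<d (<⇒≤ (<-trans j<n (n<2^n n)))
      p+j≡qd+[r+j] : p + j ≡ q * d + (r + j)
      p+j≡qd+[r+j] = trans (cong (_+ j) (m≡m%n+[m/n]*n p d)) (regroup r (q * d) j)
        where
        regroup : ∀ a b c → a + b + c ≡ b + (a + c)
        regroup = solve-∀
    p′<6d : q′ * d + r < 6 * d
    p′<6d = begin-strict
      q′ * d + r     <⟨ +-monoʳ-< (q′ * d) r<d ⟩
      q′ * d + d     ≡⟨ +-comm (q′ * d) d ⟩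
      suc q′ * d     ≤⟨ *-monoˡ-≤ d (s≤s q′≤5) ⟩
      6 * d          ∎

lookup-allPairs : ∀ {a r} {A : Set a} {R : Rel A r} {xs : List A} → AllPairs R xs →
  ∀ {i j : Fin (length xs)} → i Fin.< j → R (lookup xs i) (lookup xs j)
lookup-allPairs (head ∷ _)    {Fin.zero}  {Fin.suc j} _         = All.lookup head (∈-lookup j)
lookup-allPairs (_ ∷ pairs)   {Fin.suc i} {Fin.suc j} (s≤s i<j) = lookup-allPairs pairs i<j

module Classes {ℓ} {_∼_ : Rel ℕ ℓ} (isDecEquivalence : IsDecEquivalence _∼_) where

  open IsDecEquivalence isDecEquivalence using () renaming (sym to ∼-sym; trans to ∼-trans; _≟_ to _∼?_)

  Representatives : ℕ → Set ℓ
  Representatives k = Σ (Fin k → ℕ) λ rep →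
      ((i j : Fin k) → i ≢ j → ¬ rep i ∼ rep j) × ((p : ℕ) → ∃ λ (i : Fin k) → p ∼ rep i)

  representatives : ∀ B → (∀ p → ∃ λ p′ → p′ < B × p ∼ p′) → ∃ Representatives
  representatives B recurrent = length ys , lookup ys , distinct , cover
    where
    ys = deduplicate _∼?_ (upTo B)
    unique : AllPairs (λ p q → ¬ p ∼ q) ys
    unique = deduplicate-! (record { isDecEquivalence = isDecEquivalence }) (upTo B)
    distinct : (i j : Fin (length ys)) → i ≢ j → ¬ lookup ys i ∼ lookup ys j
    distinct i j i≢j with Fin.<-cmp i j
    ... | tri< i<j _ _ = lookup-allPairs unique i<j
    ... | tri≈ _ i≡j _ = ⊥-elim (i≢j i≡j)
    ... | tri> _ _ j<i = λ i∼j → lookup-allPairs unique j<i (∼-sym i∼j)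
    cover : (p : ℕ) → ∃ λ (i : Fin (length ys)) → p ∼ lookup ys i
    cover p with p′ , p′<B , p∼p′ ← recurrent p = Any.index p∼ys , lookup-index p∼ys
      where
      p∼ys : Any (p ∼_) ys
      p∼ys = deduplicate⁺ _∼?_ (λ q∼r p∼q → ∼-trans p∼q (∼-sym q∼r)) (Any.map (λ { refl → p∼p′ }) (∈-upTo⁺ p′<B))

  classes≤ : ∀ {k S} → Representatives k → (key : ℕ → Fin S) → (∀ p q → key p ≡ key q → p ∼ q) → k ≤ S
  classes≤ (rep , distinct , _) key classifies = injective⇒≤ separated
    where
    separated : ∀ {i j} → key (rep i) ≡ key (rep j) → i ≡ j
    separated {i} {j} same with i Fin.≟ j
    ... | yes i≡j = i≡j
    ... | no  i≢j = ⊥-elim (distinct i j i≢j (classifies _ _ same))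

  ≤classes : ∀ {k j} → Representatives k → (h : Fin j → ℕ) → (∀ a b → h a ∼ h b → a ≡ b) → j ≤ k
  ≤classes (rep , _ , cover) h separated = injective⇒≤ {f = λ a → proj₁ (cover (h a))} same-class
    where
    same-class : ∀ {a b} → proj₁ (cover (h a)) ≡ proj₁ (cover (h b)) → a ≡ b
    same-class {a} {b} eq = separated a b (∼-trans (proj₂ (cover (h a)))
      (∼-sym (subst (λ i → h b ∼ rep i) (sym eq) (proj₂ (cover (h b))))))

-- HasP2 n k unfolds to FactorClasses.Representatives n k.
module FactorClasses (n : ℕ) = Classes (On.isDecEquivalence (λ p → factor p n) ≈₂-isDecEquivalence)

classCount : ∀ n → ∃ (HasP2 n)
classCount n = FactorClasses.representatives n (6 * 2 ^ n) recurrent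
  where
  recurrent : ∀ p → ∃ λ p′ → p′ < 6 * 2 ^ n × factor p n ≈₂ factor p′ n
  recurrent p with p′ , p′<B , same ← factor-recurrence n p = p′ , p′<B , λ w _ _ → cong (occ w) same

bit : Bool → Fin 2
bit false = Fin.zero
bit true  = Fin.suc Fin.zero

bit-injective : ∀ {a b} → bit a ≡ bit b → a ≡ b
bit-injective {false} {false} _ = refl
bit-injective {true}  {true}  _ = refl

module _ (f : ℕ → ℕ) where

  rangeKey : ∀ lo w → (∀ p → lo ≤ f p × f p ≤ lo + w) → ℕ → Fin (suc w)
  rangeKey lo w inRange p = Fin.fromℕ< (s≤s (m≤n+o⇒m∸n≤o (f p) lo (proj₂ (inRange p))))

  rangeKey-injective : ∀ lo w inRange {p q} → rangeKey lo w inRange p ≡ rangeKey lo w inRange q → f p ≡ f q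
  rangeKey-injective lo w inRange {p} {q} same =
    ∸-cancelʳ-≡ (proj₁ (inRange p)) (proj₁ (inRange q)) (Fin.fromℕ<-injective _ _ _ _ same)

  spread⇒inRange : ∀ {d} → Spread f d → ∀ p → f 0 ∸ d ≤ f p × f p ≤ (f 0 ∸ d) + (d + d)
  spread⇒inRange {d} spr p = m≤n+o⇒m∸n≤o (f 0) d (subst (f 0 ≤_) (+-comm (f p) d) (spr 0 p)) , (begin
    f p                    ≤⟨ spr p 0 ⟩
    f 0 + d                ≤⟨ +-monoˡ-≤ d (m≤n+m∸n (f 0) d) ⟩
    d + (f 0 ∸ d) + d      ≡⟨ regroup d (f 0 ∸ d) ⟩
    (f 0 ∸ d) + (d + d)    ∎)
    where
    regroup : ∀ d x → d + x + d ≡ x + (d + d)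
    regroup = solve-∀

  spreadKey : ∀ d → Spread f d → ℕ → Fin (suc (d + d))
  spreadKey d spr = rangeKey (f 0 ∸ d) (d + d) (spread⇒inRange spr)

  spreadKey-injective : ∀ d spr {p q} → spreadKey d spr p ≡ spreadKey d spr q → f p ≡ f q
  spreadKey-injective d spr = rangeKey-injective (f 0 ∸ d) (d + d) (spread⇒inRange spr)

endsKey : ℕ → ℕ → Fin (2 * 2)
endsKey L p = Fin.combine (bit (T p)) (bit (T (p + L)))

endsKey-injective : ∀ L {p q} → endsKey L p ≡ endsKey L q → T p ≡ T q × T (p + L) ≡ T (q + L)
endsKey-injective L {p} {q} same with first , last ← Fin.combine-injective (bit (T p)) _ (bit (T q)) _ same =
  bit-injective first , bit-injective last

-- Key: the two end letters, the number of 0s (spread 2, so 5 values) and the number of squares.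
classes≤-squareSpread : ∀ L D {k} → Spread (λ s → squares s L) D → HasP2 (suc L) k → k ≤ 2 * 2 * (5 * suc (D + D))
classes≤-squareSpread L D spr hasP2 = FactorClasses.classes≤ (suc L) hasP2 key classifies
  where
  zeroKey : ℕ → Fin 5
  zeroKey = spreadKey (λ p → zeros p (suc L)) 2 (zeros-spread (suc L))
  squareKey : ℕ → Fin (suc (D + D))
  squareKey = spreadKey (λ s → squares s L) D spr
  key : ℕ → Fin (2 * 2 * (5 * suc (D + D)))
  key p = Fin.combine (endsKey L p) (Fin.combine (zeroKey p) (squareKey p))
  classifies : ∀ p q → key p ≡ key q → factor p (suc L) ≈₂ factor q (suc L)
  classifies p q same = ≈₂-window p q L (proj₁ ends) (proj₂ ends)
      (spreadKey-injective (λ p → zeros p (suc L)) 2 (zeros-spread (suc L)) (proj₁ counts))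
      (spreadKey-injective (λ s → squares s L) D spr (proj₂ counts))
    where
    parts = Fin.combine-injective (endsKey L p) _ (endsKey L q) _ same
    ends = endsKey-injective L {p} {q} (proj₁ parts)
    counts = Fin.combine-injective (zeroKey p) _ (zeroKey q) _ (proj₂ parts)

classes≤8 : ∀ m {k} → HasP2 (suc (2 ^ m)) k → k ≤ 8
classes≤8 zero    hasP2 = ≤-trans (FactorClasses.classes≤ 2 hasP2 (endsKey 1) classifies) (+-monoʳ-≤ 4 z≤n)
  where
  classifies : ∀ p q → endsKey 1 p ≡ endsKey 1 q → factor p 2 ≈₂ factor q 2
  classifies p q same = λ w _ _ → cong (occ w) (factor-cong p q 2 agree)
    where
    agree : ∀ j → j < 2 → T (p + j) ≡ T (q + j)
    agree zero          _ = trans (cong T (+-identityʳ p)) (trans (proj₁ (endsKey-injective 1 {p} {q} same)) (cong T (sym (+-identityʳ q))))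
    agree (suc zero)    _ = proj₂ (endsKey-injective 1 {p} {q} same)
    agree (suc (suc _)) (s≤s (s≤s ()))
classes≤8 (suc m) hasP2 = FactorClasses.classes≤ (suc L) hasP2 key classifies
  where
  h = 2 ^ m
  L = 2 ^ suc m
  zeros-range : ∀ p → h ≤ zeros p (suc L) × zeros p (suc L) ≤ h + 1
  zeros-range p = subst (λ L → h ≤ zeros p (suc L) × zeros p (suc L) ≤ h + 1) (sym (2^-suc m))
    (subst (λ h+1 → h ≤ zeros p (suc (h + h)) × zeros p (suc (h + h)) ≤ h+1) (+-comm 1 h) (zeros-2h+1 h p))
  zeroKey : ℕ → Fin 2
  zeroKey = rangeKey (λ p → zeros p (suc L)) h 1 zeros-range
  key : ℕ → Fin (2 * 2 * 2)
  key p = Fin.combine (endsKey L p) (zeroKey p)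
  classifies : ∀ p q → key p ≡ key q → factor p (suc L) ≈₂ factor q (suc L)
  classifies p q same = ≈₂-window p q L first last z
      (same-parity-close⇒≡ {a = proj₁ (squares-parity p L)} {b = A′} (proj₂ (squares-parity p L)) parity-q (squareSpread-2^ (suc m) p q) (squareSpread-2^ (suc m) q p))
    where
    parts = Fin.combine-injective (endsKey L p) _ (endsKey L q) _ same
    first = proj₁ (endsKey-injective L {p} {q} (proj₁ parts))
    last = proj₂ (endsKey-injective L {p} {q} (proj₁ parts))
    z = rangeKey-injective (λ p → zeros p (suc L)) h 1 zeros-range (proj₂ parts)
    A′ = proj₁ (squares-parity q L)
    parity-q : squares q L + (δ true (T p) + (zeros p (suc L) + zeros p (suc L))) ≡ A′ + A′ + (suc L + δ false (T (p + L)))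
    parity-q = begin-equality
      squares q L + (δ true (T p) + (zeros p (suc L) + zeros p (suc L)))  ≡⟨ cong₂ (λ t n₀ → squares q L + (δ true t + (n₀ + n₀))) first z ⟩
      squares q L + (δ true (T q) + (zeros q (suc L) + zeros q (suc L)))  ≡⟨ proj₂ (squares-parity q L) ⟩
      A′ + A′ + (suc L + δ false (T (q + L)))                            ≡⟨ cong (λ t → A′ + A′ + (suc L + δ false t)) last ⟨
      A′ + A′ + (suc L + δ false (T (p + L)))                            ∎

classes≥spectrum : ∀ m {k} → HasP2 (suc (ℓ₄ m)) k → suc m ≤ k
classes≥spectrum m hasP2 = FactorClasses.≤classes (suc (ℓ₄ m)) hasP2 witness separated
  where
  base = proj₁ (squares-spectrum m)
  family = proj₂ (squares-spectrum m)
  in-range : (a : Fin (suc m)) → Fin.toℕ a ≤ m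
  in-range a = s≤s⁻¹ (Fin.toℕ<n a)
  witness : Fin (suc m) → ℕ
  witness a = proj₁ (family (Fin.toℕ a) (in-range a))
  separated : ∀ a b → factor (witness a) (suc (ℓ₄ m)) ≈₂ factor (witness b) (suc (ℓ₄ m)) → a ≡ b
  separated a b same = Fin.toℕ-injective (+-cancelˡ-≡ base _ _ (begin-equality
    base + Fin.toℕ a              ≡⟨ proj₂ (family (Fin.toℕ a) (in-range a)) ⟨
    squares (witness a) (ℓ₄ m)    ≡⟨ squares-invariant (witness a) (witness b) (ℓ₄ m) same ⟩
    squares (witness b) (ℓ₄ m)    ≡⟨ proj₂ (family (Fin.toℕ b) (in-range b)) ⟩
    base + Fin.toℕ b              ∎))

n<2^[1+⌊log₂n⌋] : ∀ n → n < 2 ^ suc ⌊log₂ n ⌋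
n<2^[1+⌊log₂n⌋] n with n <? 2 ^ suc ⌊log₂ n ⌋
... | yes n<2^ = n<2^
... | no  n≮2^ = ⊥-elim (n≮n ⌊log₂ n ⌋
  (subst (_≤ ⌊log₂ n ⌋) (⌊log₂[2^n]⌋≡n (suc ⌊log₂ n ⌋)) (⌊log₂⌋-mono-≤ (≮⇒≥ n≮2^))))

1≤⌊log₂n⌋ : ∀ {n} → 2 ≤ n → 1 ≤ ⌊log₂ n ⌋
1≤⌊log₂n⌋ {n} 2≤n = subst (_≤ ⌊log₂ n ⌋) (⌊log₂[2^n]⌋≡n 1) (⌊log₂⌋-mono-≤ 2≤n)

P2-logarithmic : ∃ λ C → ∃ λ N → ∀ n → N ≤ n → ∃ λ k → HasP2 n k × k ≤ C * ⌊log₂ n ⌋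
P2-logarithmic = 100 , 2 , bound
  where
  bound : ∀ n → 2 ≤ n → ∃ λ k → HasP2 n k × k ≤ 100 * ⌊log₂ n ⌋
  bound (suc L) 2≤n = k , hasP2 , (begin
    k                                      ≤⟨ classes≤-squareSpread L (suc lg) spread hasP2 ⟩
    2 * 2 * (5 * suc (suc lg + suc lg))    ≡⟨ regroup lg ⟩
    60 + 40 * lg                           ≤⟨ +-monoˡ-≤ (40 * lg) (*-monoʳ-≤ 60 (1≤⌊log₂n⌋ 2≤n)) ⟩
    60 * lg + 40 * lg                      ≡⟨ *-distribʳ-+ lg 60 40 ⟨
    100 * lg                               ∎)
    where
    k = proj₁ (classCount (suc L))
    hasP2 = proj₂ (classCount (suc L))
    lg = ⌊log₂ suc L ⌋
    spread = squareSpread-log (suc lg) L (<-trans (n<1+n L) (n<2^[1+⌊log₂n⌋] (suc L)))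
    regroup : ∀ l → 2 * 2 * (5 * suc (suc l + suc l)) ≡ 60 + 40 * l
    regroup = solve-∀

P2-family : ∃ λ a → ∃ λ b → ∃ λ M → ∀ m → M ≤ m →
  ∃ λ k → HasP2 ((2 * 4 ^ m + 4) / 3) k × m ≤ a * k × k ≤ b * m
P2-family = 1 , 140 , 1 , bound
  where
  bound : ∀ m → 1 ≤ m → ∃ λ k → HasP2 ((2 * 4 ^ m + 4) / 3) k × m ≤ 1 * k × k ≤ 140 * m
  bound m 1≤m = k , hasP2 , lower , upper
    where
    k = proj₁ (classCount ((2 * 4 ^ m + 4) / 3))
    hasP2 = proj₂ (classCount ((2 * 4 ^ m + 4) / 3))
    hasP2′ : HasP2 (suc (ℓ₄ m)) k
    hasP2′ = subst (λ n → HasP2 n k) ([2*4^m+4]/3≡1+ℓ₄ m) hasP2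
    lower : m ≤ 1 * k
    lower = subst (m ≤_) (sym (*-identityˡ k)) (<⇒≤ (classes≥spectrum m hasP2′))
    upper : k ≤ 140 * m
    upper = begin
      k                                            ≤⟨ classes≤-squareSpread (ℓ₄ m) (suc (m + m)) (squareSpread-log _ _ (ℓ₄<2^[1+2m] m)) hasP2′ ⟩
      2 * 2 * (5 * suc (suc (m + m) + suc (m + m))) ≡⟨ regroup m ⟩
      60 + 80 * m                                  ≤⟨ +-monoˡ-≤ (80 * m) (*-monoʳ-≤ 60 1≤m) ⟩
      60 * m + 80 * m                              ≡⟨ *-distribʳ-+ m 60 80 ⟨
      140 * m                                      ∎
      where
      regroup : ∀ m → 2 * 2 * (5 * suc (suc (m + m) + suc (m + m))) ≡ 60 + 80 * m
      regroup = solve-∀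

P2-2^+1≤8 : ∀ m → ∃ λ k → HasP2 (2 ^ m + 1) k × k ≤ 8
P2-2^+1≤8 m = k , hasP2 , classes≤8 m (subst (λ n → HasP2 n k) (+-comm (2 ^ m) 1) hasP2)
  where
  k = proj₁ (classCount (2 ^ m + 1))
  hasP2 = proj₂ (classCount (2 ^ m + 1))

lemma10 : (∃ λ (C : ℕ) → ∃ λ (N : ℕ) → (n : ℕ) → N ≤ n →
    ∃ λ (k : ℕ) → HasP2 n k × k ≤ C * ⌊log₂ n ⌋)
    × (∃ λ (a : ℕ) → ∃ λ (b : ℕ) → ∃ λ (M : ℕ) → (m : ℕ) → M ≤ m →
    ∃ λ (k : ℕ) → HasP2 ((2 * 4 ^ m + 4) / 3) k × m ≤ a * k × k ≤ b * m)
    × ((m : ℕ) → ∃ λ (k : ℕ) → HasP2 (2 ^ m + 1) k × k ≤ 8)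
lemma10 = P2-logarithmic , P2-family , P2-2^+1≤8
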